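{- The derivation system of QHC, consisting of (0a), (0b) and (1a)–(2f) below, is equivalent (each is derivable from the other by the meta-rules) to the derivation system consisting of: - all laws and rules of QC (for c-formulas) and of QH (for i-formulas); - the rules $p/\,!p$ and $\alpha/\,?\alpha$; - the principles $\cdot\,?!p\to p$, $\cdot\,\alpha\to\,!?\alpha$, $\cdot\,!(p\to q)\to(!p\to !q)$, $\cdot\,?(\alpha\to\beta)\to(?\alpha\to ?\beta)$ and $\cdot\,\neg !\bot$.
   Context: Meta-logical framework. Formulas of a first-order language may contain individual variables and predicate variables. Meta-formulas are built from formulas using meta-conjunction $\&$, meta-implication $\Rightarrow$, and universal meta-quantifiers over individual and predicate variables. A principle $\cdot G$, for a formula $G$, is the meta-formula obtained by universally meta-quantifying all free individual variables of $G$ and then all predicate variables of $G$. A rule $F_1,\dots,F_m/G$ is the meta-formula $\forall^2(\forall^1F_1\,\&\cdots\&\,\forall^1F_m\Rightarrow\forall^1G)$, where $\forall^1$ meta-quantifies the free individual variables of the formula it precedes and $\forall^2$ meta-quantifies all predicate variables occurring. A derivation system is a meta-conjunction $\mathcal D$ of finitely many principles and rules. Two derivation systems $\mathcal D,\mathcal D'$ are equivalent if $(\mathcal D\Rightarrow\mathcal D')\&(\mathcal D'\Rightarrow\mathcal D)$ is derivable by the natural-deduction meta-rules: introduction and elimination of $\&$, $\Rightarrow$ and the universal meta-quantifiers (elimination allows substituting terms for individual variables and formulas for predicate variables), plus $\alpha$-conversion. Language of QHC. It has individual variables and, for each $n\ge0$, countably many $n$-ary problem variables $\alpha,\beta,\gamma,\delta,\theta,\dots$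 and countably many $n$-ary proper predicate variables $p,q,\dots$. - A c-formula is $\top$, $\bot$, an atom $p(x_1,\dots,x_n)$, or $?\Phi$ for an i-formula $\Phi$, closed under the classical connectives $\land,\lor,\to,\leftrightarrow,\neg$ and quantifiers $\exists,\forall$. - An i-formula is $\checkmark$ (triviality), $\curlywedge$ (absurdity), an atom $\alpha(x_1,\dots,x_n)$, or $!F$ for a c-formula $F$, closed under the intuitionistic connectives $\land,\lor,\to,\leftrightarrow,\neg$ (with $\neg\Phi:=\Phi\to\curlywedge$) and quantifiers $\exists,\forall$. Connectives applied to c-formulas are classical; those applied to i-formulas are intuitionistic. The derivation system of QHC consists of: - (0a) all laws and rules of classical predicate logic QC, applied to c-formulas; - (0b) all laws and rules of intuitionistic predicate logic QH, applied to i-formulas; - (1a) $\cdot\,?(\gamma\land\delta)\leftrightarrow ?\gamma\land ?\delta$; - (1b) $\cdot\,?(\gamma\lor\delta)\leftrightarrow ?\gamma\lor ?\delta$; - (1c) $\cdot\,?(\gamma\to\delta)\to(?\gamma\to ?\delta)$; - (1d) $\cdot\,\neg ?\curlywedge$; - (1e) $\cdot\,?\exists x\,\theta(x)\leftrightarrow\exists x\,?\theta(x)$; - (1f) $\cdot\,?\forall x\,\theta(x)\to\forall x\,?\theta(x)$; - (1g) $\cdot\,\gamma\to\,!?\gamma$; - (2a) $\cdot\,\neg !\bot$; - (2b) $\cdot\,?!p\to p$; - (2c) the rule $!p/p$; - (2d) $\cdot\,!p\to\,!?!p$; - (2e) $\cdot\,!(p\to q)\to(!p\to !q)$; - (2f)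 the rule $p/!p$. -}

module Defs where

open import Data.Nat using (ℕ; zero; suc; _+_)
open import Data.Fin using (Fin; zero; suc; _↑ˡ_; _↑ʳ_; splitAt)
open import Data.Vec using (Vec; []; _∷_; lookup; tabulate)
import Data.Vec as Vec
open import Data.List using (List; []; _∷_)
import Data.List as List
open import Data.List.NonEmpty using (List⁺; _∷_)
open import Data.List.Membership.Propositional using (_∈_)
open import Data.Product using (Σ; _×_; _,_)
open import Data.Sum using (inj₁; inj₂)

-- Sorts: c (classical / propositions) and i (intuitionistic / problems)

data Sort : Set where
  c i : Sort

-- A variable of sort c is a proper predicate variable (p, q, ...),
-- a variable of sort i is a problem variable (α, β, γ, δ, θ, ...).
Ctx : Set
Ctx = List (Sort × ℕ)

data _∋_ : Ctx → Sort × ℕ → Set where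
  here  : ∀ {Δ x} → (x ∷ Δ) ∋ x
  there : ∀ {Δ x y} → Δ ∋ x → (y ∷ Δ) ∋ x

infix 4 _∋_

-- Fm c Δ n = c-formulas, Fm i Δ n = i-formulas, with
-- predicate variables from Δ and n free individual variables (de Bruijn,
-- the innermost binder is 'zero').  Connectives at sort c are the classical
-- ones, at sort i the intuitionistic ones.  The only terms are variables.

infixr 6 _∧_
infixr 5 _∨_
infixr 4 _⇒_ _⇔_

data Fm : Sort → Ctx → ℕ → Set where
  tt   : ∀ {s Δ n} → Fm s Δ n
  ff   : ∀ {s Δ n} → Fm s Δ n
  atom : ∀ {s Δ n k} → Δ ∋ (s , k) → Vec (Fin n) k → Fm s Δ n
  ¿    : ∀ {Δ n} → Fm i Δ n → Fm c Δ n
  ‼    : ∀ {Δ n} → Fm c Δ n → Fm i Δ n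
  _∧_ _∨_ _⇒_ : ∀ {s Δ n} → Fm s Δ n → Fm s Δ n → Fm s Δ n
  ∀' ∃' : ∀ {s Δ n} → Fm s Δ (suc n) → Fm s Δ n

¬_ : ∀ {s Δ n} → Fm s Δ n → Fm s Δ n
¬ F = F ⇒ ff

_⇔_ : ∀ {s Δ n} → Fm s Δ n → Fm s Δ n → Fm s Δ n
F ⇔ G = (F ⇒ G) ∧ (G ⇒ F)

ext : ∀ {n m} → (Fin n → Fin m) → Fin (suc n) → Fin (suc m)
ext ρ zero    = zero
ext ρ (suc j) = suc (ρ j)

ren : ∀ {s Δ n m} → (Fin n → Fin m) → Fm s Δ n → Fm s Δ m
ren ρ tt = tt
ren ρ ff = ff
ren ρ (atom v ts) = atom v (Vec.map ρ ts)
ren ρ (¿ F) = ¿ (ren ρ F)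
ren ρ (‼ F) = ‼ (ren ρ F)
ren ρ (F ∧ G) = ren ρ F ∧ ren ρ G
ren ρ (F ∨ G) = ren ρ F ∨ ren ρ G
ren ρ (F ⇒ G) = ren ρ F ⇒ ren ρ G
ren ρ (∀' F) = ∀' (ren (ext ρ) F)
ren ρ (∃' F) = ∃' (ren (ext ρ) F)

PRen : Ctx → Ctx → Set
PRen Δ Δ' = ∀ {x} → Δ ∋ x → Δ' ∋ x

pren : ∀ {s Δ Δ' n} → PRen Δ Δ' → Fm s Δ n → Fm s Δ' n
pren ρ tt = tt
pren ρ ff = ff
pren ρ (atom v ts) = atom (ρ v) ts
pren ρ (¿ F) = ¿ (pren ρ F)
pren ρ (‼ F) = ‼ (pren ρ F)
pren ρ (F ∧ G) = pren ρ F ∧ pren ρ G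
pren ρ (F ∨ G) = pren ρ F ∨ pren ρ G
pren ρ (F ⇒ G) = pren ρ F ⇒ pren ρ G
pren ρ (∀' F) = ∀' (pren ρ F)
pren ρ (∃' F) = ∃' (pren ρ F)

pext : ∀ {Δ Δ' y} → PRen Δ Δ' → PRen (y ∷ Δ) (y ∷ Δ')
pext ρ here      = here
pext ρ (there v) = there (ρ v)

-- A k-ary variable is replaced by a formula in scope k + n whose first k
-- individual variables are the parameters x₁ … x_k and the remaining n
-- are the ambient free variables.

PSub : Ctx → Ctx → ℕ → Set
PSub Δ Δ' n = ∀ {s k} → Δ ∋ (s , k) → Fm s Δ' (k + n)

shiftAmb : ∀ k {n} → Fin (k + n) → Fin (k + suc n)
shiftAmb k {n} j with splitAt k j
... | inj₁ a = a ↑ˡ suc n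
... | inj₂ b = k ↑ʳ suc b

inst : ∀ {k n} → Vec (Fin n) k → Fin (k + n) → Fin n
inst {k} ts j with splitAt k j
... | inj₁ a = lookup ts a
... | inj₂ b = b

liftI : ∀ {Δ Δ' n} → PSub Δ Δ' n → PSub Δ Δ' (suc n)
liftI σ {k = k} v = ren (shiftAmb k) (σ v)

params : ∀ k n → Vec (Fin (k + n)) k
params k n = tabulate (λ a → a ↑ˡ n)

liftP : ∀ {Δ Δ' n y} → PSub Δ Δ' n → PSub (y ∷ Δ) (y ∷ Δ') n
liftP {n = n} σ {k = k} here = atom here (params k n)
liftP σ (there v) = pren there (σ v)

psub : ∀ {s Δ Δ' n} → PSub Δ Δ' n → Fm s Δ n → Fm s Δ' n
psub σ tt = tt
psub σ ff = ff
psub σ (atom v ts) = ren (inst ts) (σ v)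
psub σ (¿ F) = ¿ (psub σ F)
psub σ (‼ F) = ‼ (psub σ F)
psub σ (F ∧ G) = psub σ F ∧ psub σ G
psub σ (F ∨ G) = psub σ F ∨ psub σ G
psub σ (F ⇒ G) = psub σ F ⇒ psub σ G
psub σ (∀' F) = ∀' (psub (liftI σ) F)
psub σ (∃' F) = ∃' (psub (liftI σ) F)

infixr 3 _&_
infixr 2 _⟹_

data MF : Ctx → ℕ → Set where
  fm   : ∀ {s Δ n} → Fm s Δ n → MF Δ n
  _&_ _⟹_ : ∀ {Δ n} → MF Δ n → MF Δ n → MF Δ n
  Π₁   : ∀ {Δ n} → MF Δ (suc n) → MF Δ n
  Π₂   : ∀ {Δ n} (x : Sort × ℕ) → MF (x ∷ Δ) n → MF Δ n

mren : ∀ {Δ n m} → (Fin n → Fin m) → MF Δ n → MF Δ m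
mren ρ (fm F) = fm (ren ρ F)
mren ρ (φ & ψ) = mren ρ φ & mren ρ ψ
mren ρ (φ ⟹ ψ) = mren ρ φ ⟹ mren ρ ψ
mren ρ (Π₁ φ) = Π₁ (mren (ext ρ) φ)
mren ρ (Π₂ x φ) = Π₂ x (mren ρ φ)

mpren : ∀ {Δ Δ' n} → PRen Δ Δ' → MF Δ n → MF Δ' n
mpren ρ (fm F) = fm (pren ρ F)
mpren ρ (φ & ψ) = mpren ρ φ & mpren ρ ψ
mpren ρ (φ ⟹ ψ) = mpren ρ φ ⟹ mpren ρ ψ
mpren ρ (Π₁ φ) = Π₁ (mpren ρ φ)
mpren ρ (Π₂ x φ) = Π₂ x (mpren (pext ρ) φ)

mpsub : ∀ {Δ Δ' n} → PSub Δ Δ' n → MF Δ n → MF Δ' n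
mpsub σ (fm F) = fm (psub σ F)
mpsub σ (φ & ψ) = mpsub σ φ & mpsub σ ψ
mpsub σ (φ ⟹ ψ) = mpsub σ φ ⟹ mpsub σ ψ
mpsub σ (Π₁ φ) = Π₁ (mpsub (liftI σ) φ)
mpsub σ (Π₂ x φ) = Π₂ x (mpsub (liftP σ) φ)

wk₁ : ∀ {Δ n} → MF Δ n → MF Δ (suc n)
wk₁ = mren suc

wk₂ : ∀ {Δ n x} → MF Δ n → MF (x ∷ Δ) n
wk₂ = mpren there

inst₁ : ∀ {n} → Fin n → Fin (suc n) → Fin n
inst₁ t zero    = t
inst₁ t (suc j) = j

_[_]₁ : ∀ {Δ n} → MF Δ (suc n) → Fin n → MF Δ n
φ [ t ]₁ = mren (inst₁ t) φ

idSub : ∀ {Δ n} → PSub Δ Δ n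
idSub {n = n} {k = k} v = atom v (params k n)

single : ∀ {Δ n s k} → Fm s Δ (k + n) → PSub ((s , k) ∷ Δ) Δ n
single F here      = F
single F (there v) = idSub v

_[_]₂ : ∀ {Δ n s k} → MF ((s , k) ∷ Δ) n → Fm s Δ (k + n) → MF Δ n
φ [ F ]₂ = mpsub (single F) φ

-- Natural deduction for meta-formulas: introduction and elimination of
-- &, ⟹, Π₁, Π₂ (α-conversion is built in via de Bruijn indices).
-- 'fresh' allows using an individual variable not among the current ones
-- (as in named-variable natural deduction, where a fresh variable may be
-- used as an instantiating term).

infix 1 _⊢_

data _⊢_ {Δ : Ctx} {n : ℕ} : List (MF Δ n) → MF Δ n → Set where
  hyp  : ∀ {Γ φ} → φ ∈ Γ → Γ ⊢ φ
  &I   : ∀ {Γ φ ψ} → Γ ⊢ φ → Γ ⊢ ψ → Γ ⊢ φ & ψ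
  &E₁  : ∀ {Γ φ ψ} → Γ ⊢ φ & ψ → Γ ⊢ φ
  &E₂  : ∀ {Γ φ ψ} → Γ ⊢ φ & ψ → Γ ⊢ ψ
  ⟹I  : ∀ {Γ φ ψ} → (φ ∷ Γ) ⊢ ψ → Γ ⊢ φ ⟹ ψ
  ⟹E  : ∀ {Γ φ ψ} → Γ ⊢ φ ⟹ ψ → Γ ⊢ φ → Γ ⊢ ψ
  Π₁I  : ∀ {Γ φ} → List.map wk₁ Γ ⊢ φ → Γ ⊢ Π₁ φ
  Π₁E  : ∀ {Γ φ} → Γ ⊢ Π₁ φ → (t : Fin n) → Γ ⊢ φ [ t ]₁
  Π₂I  : ∀ {Γ x φ} → List.map wk₂ Γ ⊢ φ → Γ ⊢ Π₂ x φ
  Π₂E  : ∀ {Γ s k φ} → Γ ⊢ Π₂ (s , k) φ → (F : Fm s Δ (k + n)) → Γ ⊢ φ [ F ]₂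
  fresh : ∀ {Γ φ} → List.map wk₁ Γ ⊢ wk₁ φ → Γ ⊢ φ

Π₁* : ∀ {Δ} n → MF Δ n → MF Δ 0
Π₁* zero φ    = φ
Π₁* (suc n) φ = Π₁* n (Π₁ φ)

Π₂* : ∀ Δ → MF Δ 0 → MF [] 0
Π₂* [] φ      = φ
Π₂* (x ∷ Δ) φ = Π₂* Δ (Π₂ x φ)

Sch : Ctx → Set
Sch Δ = Σ ℕ (λ n → Σ Sort (λ s → Fm s Δ n))

cl₁ : ∀ {Δ} → Sch Δ → MF Δ 0
cl₁ (n , s , G) = Π₁* n (fm G)

principle : ∀ {s} (Δ : Ctx) (n : ℕ) → Fm s Δ n → MF [] 0
principle Δ n G = Π₂* Δ (cl₁ (n , _ , G))

conj⁺ : ∀ {Δ n} → MF Δ n → List (MF Δ n) → MF Δ n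
conj⁺ φ []       = φ
conj⁺ φ (ψ ∷ ψs) = φ & conj⁺ ψ ψs

rule : (Δ : Ctx) → List⁺ (Sch Δ) → Sch Δ → MF [] 0
rule Δ (F ∷ Fs) G = Π₂* Δ (conj⁺ (cl₁ F) (List.map cl₁ Fs) ⟹ cl₁ G)

system : List⁺ (MF [] 0) → MF [] 0
system (φ ∷ φs) = conj⁺ φ φs

infixr 5 _++⁺_
_++⁺_ : ∀ {A : Set} → List A → List⁺ A → List⁺ A
[] ++⁺ ys = ys
(x ∷ xs) ++⁺ (y ∷ ys) = x ∷ (xs List.++ (y ∷ ys))

Equivalent : MF [] 0 → MF [] 0 → Set
Equivalent D D' = [] ⊢ (D ⟹ D') & (D' ⟹ D)

v₀ : ∀ {Δ x} → (x ∷ Δ) ∋ x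
v₀ = here
v₁ : ∀ {Δ x y} → (y ∷ x ∷ Δ) ∋ x
v₁ = there here
v₂ : ∀ {Δ x y z} → (z ∷ y ∷ x ∷ Δ) ∋ x
v₂ = there (there here)

a₀ : ∀ {s Δ n} → Δ ∋ (s , 0) → Fm s Δ n
a₀ v = atom v []

a₁ : ∀ {s Δ n} → Δ ∋ (s , 1) → Fm s Δ (suc n)
a₁ v = atom v (zero ∷ [])

-- A finite axiomatization of the laws and rules of QC (s = c) and QH
-- (s = i) by principles and rules with predicate variables (Hilbert style,
-- Kleene's system; schemata are predicate variables, instances are
-- obtained by the meta-rule Π₂E).

ctx : Sort → ℕ → Ctx
ctx s zero    = []
ctx s (suc m) = (s , 0) ∷ ctx s m

logicLaws : Sort → List (MF [] 0)
logicLaws s =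
    principle (ctx s 2) 0 (a₀ v₀ ⇒ (a₀ v₁ ⇒ a₀ v₀))
  ∷ principle (ctx s 3) 0 ((a₀ v₀ ⇒ (a₀ v₁ ⇒ a₀ v₂)) ⇒ ((a₀ v₀ ⇒ a₀ v₁) ⇒ (a₀ v₀ ⇒ a₀ v₂)))
  ∷ principle (ctx s 2) 0 (a₀ v₀ ∧ a₀ v₁ ⇒ a₀ v₀)
  ∷ principle (ctx s 2) 0 (a₀ v₀ ∧ a₀ v₁ ⇒ a₀ v₁)
  ∷ principle (ctx s 2) 0 (a₀ v₀ ⇒ (a₀ v₁ ⇒ a₀ v₀ ∧ a₀ v₁))
  ∷ principle (ctx s 2) 0 (a₀ v₀ ⇒ a₀ v₀ ∨ a₀ v₁)
  ∷ principle (ctx s 2) 0 (a₀ v₁ ⇒ a₀ v₀ ∨ a₀ v₁)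
  ∷ principle (ctx s 3) 0 ((a₀ v₀ ⇒ a₀ v₂) ⇒ ((a₀ v₁ ⇒ a₀ v₂) ⇒ (a₀ v₀ ∨ a₀ v₁ ⇒ a₀ v₂)))
  ∷ principle (ctx s 1) 0 (ff ⇒ a₀ v₀)
  ∷ principle {s} [] 0 tt
  -- ∀x p(x) → p(y)   and   p(y) → ∃x p(x)
  ∷ principle ((s , 1) ∷ []) 1 (∀' (a₁ v₀) ⇒ a₁ v₀)
  ∷ principle ((s , 1) ∷ []) 1 (a₁ v₀ ⇒ ∃' (a₁ v₀))
  ∷ rule (ctx s 2) ((0 , s , a₀ v₀) ∷ ((0 , s , a₀ v₀ ⇒ a₀ v₁) ∷ [])) (0 , s , a₀ v₁)
  -- q → p(y) / q → ∀x p(x)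
  ∷ rule ((s , 0) ∷ (s , 1) ∷ []) ((1 , s , a₀ v₀ ⇒ a₁ v₁) ∷ [])
         (0 , s , a₀ v₀ ⇒ ∀' (a₁ v₁))
  -- p(y) → q / ∃x p(x) → q
  ∷ rule ((s , 0) ∷ (s , 1) ∷ []) ((1 , s , a₁ v₁ ⇒ a₀ v₀) ∷ [])
         (0 , s , ∃' (a₁ v₁) ⇒ a₀ v₀)
  ∷ []

QC QH : List (MF [] 0)
QC = principle (ctx c 1) 0 (a₀ v₀ ∨ ¬ a₀ v₀) ∷ logicLaws c
QH = logicLaws i

QHC : MF [] 0
QHC = system ((QC List.++ QH) ++⁺
  ( principle (ctx i 2) 0 (¿ (a₀ v₀ ∧ a₀ v₁) ⇔ ¿ (a₀ v₀) ∧ ¿ (a₀ v₁))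
  ∷ principle (ctx i 2) 0 (¿ (a₀ v₀ ∨ a₀ v₁) ⇔ ¿ (a₀ v₀) ∨ ¿ (a₀ v₁))
  ∷ principle (ctx i 2) 0 (¿ (a₀ v₀ ⇒ a₀ v₁) ⇒ (¿ (a₀ v₀) ⇒ ¿ (a₀ v₁)))
  ∷ principle [] 0 (¬ ¿ ff)
  ∷ principle ((i , 1) ∷ []) 0 (¿ (∃' (a₁ v₀)) ⇔ ∃' (¿ (a₁ v₀)))
  ∷ principle ((i , 1) ∷ []) 0 (¿ (∀' (a₁ v₀)) ⇒ ∀' (¿ (a₁ v₀)))
  ∷ principle (ctx i 1) 0 (a₀ v₀ ⇒ ‼ (¿ (a₀ v₀)))
  ∷ principle [] 0 (¬ ‼ ff)
  ∷ principle (ctx c 1) 0 (¿ (‼ (a₀ v₀)) ⇒ a₀ v₀)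
  ∷ rule (ctx c 1) ((0 , i , ‼ (a₀ v₀)) ∷ []) (0 , c , a₀ v₀)
  ∷ principle (ctx c 1) 0 (‼ (a₀ v₀) ⇒ ‼ (¿ (‼ (a₀ v₀))))
  ∷ principle (ctx c 2) 0 (‼ (a₀ v₀ ⇒ a₀ v₁) ⇒ (‼ (a₀ v₀) ⇒ ‼ (a₀ v₁)))
  ∷ rule (ctx c 1) ((0 , c , a₀ v₀) ∷ []) (0 , i , ‼ (a₀ v₀))
  ∷ []))

QHC' : MF [] 0
QHC' = system ((QC List.++ QH) ++⁺
  ( rule (ctx c 1) ((0 , c , a₀ v₀) ∷ []) (0 , i , ‼ (a₀ v₀))
  ∷ rule (ctx i 1) ((0 , i , a₀ v₀) ∷ []) (0 , c , ¿ (a₀ v₀))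
  ∷ principle (ctx c 1) 0 (¿ (‼ (a₀ v₀)) ⇒ a₀ v₀)
  ∷ principle (ctx i 1) 0 (a₀ v₀ ⇒ ‼ (¿ (a₀ v₀)))
  ∷ principle (ctx c 2) 0 (‼ (a₀ v₀ ⇒ a₀ v₁) ⇒ (‼ (a₀ v₀) ⇒ ‼ (a₀ v₁)))
  ∷ principle (ctx i 2) 0 (¿ (a₀ v₀ ⇒ a₀ v₁) ⇒ (¿ (a₀ v₀) ⇒ ¿ (a₀ v₁)))
  ∷ principle [] 0 (¬ ‼ ff)
  ∷ []))

module Submission where

-- Both systems contain QC and QH, so only the modal parts differ.  In QHC' the
-- operators ? and ! are monotone (by their rules and K-axioms) and adjoint:
-- from α → !F one gets ?α → ?!F → F.  Hence ? preserves ∧ (monotonicity and K),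
-- ∨, ∃ and absurdity (being a left adjoint), and ?∀ → ∀? by monotonicity; the
-- rule !p/p holds because ?!p → p, and (2d) is an instance of α → !?α.
-- Conversely, in QHC the rule α/?α follows from α → !?α (1g) and !p/p (2c).

open import Defs
open import Data.Nat using (ℕ; zero; suc; _+_)
open import Data.Fin using (Fin; zero; suc; _↑ˡ_; toℕ; #_)
open import Data.Fin.Properties using (splitAt-↑ˡ)
open import Data.Vec using (Vec; []; _∷_; lookup; tabulate)
import Data.Vec as Vec
open import Data.Vec.Properties
  using (map-cong; map-∘; map-id; tabulate-∘; tabulate-cong; tabulate∘lookup; lookup∘tabulate)
open import Data.Product using (_,_)
open import Data.List using (List; []; _∷_; _++_)
import Data.List as List
open import Data.List.NonEmpty using () renaming (_∷_ to _∷⁺_)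
open import Data.List.Relation.Unary.Any using (here; there)
open import Relation.Binary.PropositionalEquality
  using (_≡_; refl; sym; trans; cong; cong₂; subst; subst₂; _≗_; module ≡-Reasoning)

ext-cong : ∀ {n m} {ρ τ : Fin n → Fin m} → ρ ≗ τ → ext ρ ≗ ext τ
ext-cong e zero    = refl
ext-cong e (suc j) = cong suc (e j)

ren-cong : ∀ {s Δ n m} {ρ τ : Fin n → Fin m} → ρ ≗ τ → (F : Fm s Δ n) → ren ρ F ≡ ren τ F
ren-cong e tt          = refl
ren-cong e ff          = refl
ren-cong e (atom v ts) = cong (atom v) (map-cong e ts)
ren-cong e (¿ F)       = cong ¿ (ren-cong e F)
ren-cong e (‼ F)       = cong ‼ (ren-cong e F)
ren-cong e (F ∧ G)     = cong₂ _∧_ (ren-cong e F) (ren-cong e G)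
ren-cong e (F ∨ G)     = cong₂ _∨_ (ren-cong e F) (ren-cong e G)
ren-cong e (F ⇒ G)     = cong₂ _⇒_ (ren-cong e F) (ren-cong e G)
ren-cong e (∀' F)      = cong ∀' (ren-cong (ext-cong e) F)
ren-cong e (∃' F)      = cong ∃' (ren-cong (ext-cong e) F)

ext-∘ : ∀ {n m k} (ρ : Fin m → Fin k) (τ : Fin n → Fin m) → (λ j → ext ρ (ext τ j)) ≗ ext (λ j → ρ (τ j))
ext-∘ ρ τ zero    = refl
ext-∘ ρ τ (suc j) = refl

ren-∘ : ∀ {s Δ n m k} (ρ : Fin m → Fin k) (τ : Fin n → Fin m) (F : Fm s Δ n) →
        ren ρ (ren τ F) ≡ ren (λ j → ρ (τ j)) F
ren-∘ ρ τ tt          = refl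
ren-∘ ρ τ ff          = refl
ren-∘ ρ τ (atom v ts) = cong (atom v) (sym (map-∘ ρ τ ts))
ren-∘ ρ τ (¿ F)       = cong ¿ (ren-∘ ρ τ F)
ren-∘ ρ τ (‼ F)       = cong ‼ (ren-∘ ρ τ F)
ren-∘ ρ τ (F ∧ G)     = cong₂ _∧_ (ren-∘ ρ τ F) (ren-∘ ρ τ G)
ren-∘ ρ τ (F ∨ G)     = cong₂ _∨_ (ren-∘ ρ τ F) (ren-∘ ρ τ G)
ren-∘ ρ τ (F ⇒ G)     = cong₂ _⇒_ (ren-∘ ρ τ F) (ren-∘ ρ τ G)
ren-∘ ρ τ (∀' F)      = cong ∀' (trans (ren-∘ (ext ρ) (ext τ) F) (ren-cong (ext-∘ ρ τ) F))
ren-∘ ρ τ (∃' F)      = cong ∃' (trans (ren-∘ (ext ρ) (ext τ) F) (ren-cong (ext-∘ ρ τ) F))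

ext-id : ∀ {n} {ρ : Fin n → Fin n} → ρ ≗ (λ j → j) → ext ρ ≗ (λ j → j)
ext-id e zero    = refl
ext-id e (suc j) = cong suc (e j)

ren-id : ∀ {s Δ n} {ρ : Fin n → Fin n} → ρ ≗ (λ j → j) → (F : Fm s Δ n) → ren ρ F ≡ F
ren-id e tt          = refl
ren-id e ff          = refl
ren-id e (atom v ts) = cong (atom v) (trans (map-cong e ts) (map-id ts))
ren-id e (¿ F)       = cong ¿ (ren-id e F)
ren-id e (‼ F)       = cong ‼ (ren-id e F)
ren-id e (F ∧ G)     = cong₂ _∧_ (ren-id e F) (ren-id e G)
ren-id e (F ∨ G)     = cong₂ _∨_ (ren-id e F) (ren-id e G)
ren-id e (F ⇒ G)     = cong₂ _⇒_ (ren-id e F) (ren-id e G)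
ren-id e (∀' F)      = cong ∀' (ren-id (ext-id e) F)
ren-id e (∃' F)      = cong ∃' (ren-id (ext-id e) F)

ren-pren : ∀ {s Δ Δ' n m} (ρ : Fin n → Fin m) (τ : PRen Δ Δ') (F : Fm s Δ n) →
           ren ρ (pren τ F) ≡ pren τ (ren ρ F)
ren-pren ρ τ tt          = refl
ren-pren ρ τ ff          = refl
ren-pren ρ τ (atom v ts) = refl
ren-pren ρ τ (¿ F)       = cong ¿ (ren-pren ρ τ F)
ren-pren ρ τ (‼ F)       = cong ‼ (ren-pren ρ τ F)
ren-pren ρ τ (F ∧ G)     = cong₂ _∧_ (ren-pren ρ τ F) (ren-pren ρ τ G)
ren-pren ρ τ (F ∨ G)     = cong₂ _∨_ (ren-pren ρ τ F) (ren-pren ρ τ G)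
ren-pren ρ τ (F ⇒ G)     = cong₂ _⇒_ (ren-pren ρ τ F) (ren-pren ρ τ G)
ren-pren ρ τ (∀' F)      = cong ∀' (ren-pren (ext ρ) τ F)
ren-pren ρ τ (∃' F)      = cong ∃' (ren-pren (ext ρ) τ F)

pren-id : ∀ {s Δ n} (F : Fm s Δ n) → pren (λ v → v) F ≡ F
pren-id tt          = refl
pren-id ff          = refl
pren-id (atom v ts) = refl
pren-id (¿ F)       = cong ¿ (pren-id F)
pren-id (‼ F)       = cong ‼ (pren-id F)
pren-id (F ∧ G)     = cong₂ _∧_ (pren-id F) (pren-id G)
pren-id (F ∨ G)     = cong₂ _∨_ (pren-id F) (pren-id G)
pren-id (F ⇒ G)     = cong₂ _⇒_ (pren-id F) (pren-id G)
pren-id (∀' F)      = cong ∀' (pren-id F)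
pren-id (∃' F)      = cong ∃' (pren-id F)

psub-pren : ∀ {s Δ Δ' Δ'' n} (σ : PSub Δ' Δ'' n) (ρ : PRen Δ Δ') (F : Fm s Δ n) →
            psub σ (pren ρ F) ≡ psub (λ v → σ (ρ v)) F
psub-pren σ ρ tt          = refl
psub-pren σ ρ ff          = refl
psub-pren σ ρ (atom v ts) = refl
psub-pren σ ρ (¿ F)       = cong ¿ (psub-pren σ ρ F)
psub-pren σ ρ (‼ F)       = cong ‼ (psub-pren σ ρ F)
psub-pren σ ρ (F ∧ G)     = cong₂ _∧_ (psub-pren σ ρ F) (psub-pren σ ρ G)
psub-pren σ ρ (F ∨ G)     = cong₂ _∨_ (psub-pren σ ρ F) (psub-pren σ ρ G)
psub-pren σ ρ (F ⇒ G)     = cong₂ _⇒_ (psub-pren σ ρ F) (psub-pren σ ρ G)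
psub-pren σ ρ (∀' F)      = cong ∀' (psub-pren (liftI σ) ρ F)
psub-pren σ ρ (∃' F)      = cong ∃' (psub-pren (liftI σ) ρ F)

inst-↑ˡ : ∀ {k n} (ts : Vec (Fin n) k) (a : Fin k) → inst ts (a ↑ˡ n) ≡ lookup ts a
inst-↑ˡ {k} {n} ts a rewrite splitAt-↑ˡ k a n = refl

shiftAmb-↑ˡ : ∀ k {n} (a : Fin k) → shiftAmb k {n} (a ↑ˡ n) ≡ a ↑ˡ suc n
shiftAmb-↑ˡ k {n} a rewrite splitAt-↑ˡ k a n = refl

inst-params : ∀ {k n} (ts : Vec (Fin n) k) → Vec.map (inst ts) (params k n) ≡ ts
inst-params {k} {n} ts =
  trans (sym (tabulate-∘ (inst ts) (_↑ˡ n)))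
        (trans (tabulate-cong (inst-↑ˡ ts)) (tabulate∘lookup ts))

shiftAmb-params : ∀ k n → Vec.map (shiftAmb k {n}) (params k n) ≡ params k (suc n)
shiftAmb-params k n = trans (sym (tabulate-∘ (shiftAmb k) (_↑ˡ n))) (tabulate-cong (shiftAmb-↑ˡ k))

_RenamesBy_ : ∀ {Δ Δ' n} → PSub Δ Δ' n → PRen Δ Δ' → Set
_RenamesBy_ {n = n} σ ρ = ∀ {s k} (v : _ ∋ (s , k)) → σ v ≡ atom (ρ v) (params k n)

liftI-renamesBy : ∀ {Δ Δ' n} {σ : PSub Δ Δ' n} {ρ : PRen Δ Δ'} → σ RenamesBy ρ → liftI σ RenamesBy ρ
liftI-renamesBy {n = n} {ρ = ρ} e {k = k} v =
  trans (cong (ren (shiftAmb k)) (e v)) (cong (atom (ρ v)) (shiftAmb-params k n))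

psub-renaming : ∀ {s Δ Δ' n} {σ : PSub Δ Δ' n} {ρ : PRen Δ Δ'} → σ RenamesBy ρ →
                (F : Fm s Δ n) → psub σ F ≡ pren ρ F
psub-renaming e tt          = refl
psub-renaming e ff          = refl
psub-renaming {ρ = ρ} e (atom v ts) = trans (cong (ren (inst ts)) (e v)) (cong (atom (ρ v)) (inst-params ts))
psub-renaming e (¿ F)       = cong ¿ (psub-renaming e F)
psub-renaming e (‼ F)       = cong ‼ (psub-renaming e F)
psub-renaming e (F ∧ G)     = cong₂ _∧_ (psub-renaming e F) (psub-renaming e G)
psub-renaming e (F ∨ G)     = cong₂ _∨_ (psub-renaming e F) (psub-renaming e G)
psub-renaming e (F ⇒ G)     = cong₂ _⇒_ (psub-renaming e F) (psub-renaming e G)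
psub-renaming e (∀' F)      = cong ∀' (psub-renaming (liftI-renamesBy e) F)
psub-renaming e (∃' F)      = cong ∃' (psub-renaming (liftI-renamesBy e) F)

ren-∘-id : ∀ {s Δ n m} {ρ : Fin m → Fin n} {τ : Fin n → Fin m} → (λ j → ρ (τ j)) ≗ (λ j → j) →
           (F : Fm s Δ n) → ren ρ (ren τ F) ≡ F
ren-∘-id e F = trans (ren-∘ _ _ F) (ren-id e F)

psub-pren-there : ∀ {s y Δ n} {σ : PSub (y ∷ Δ) Δ n} → (λ v → σ (there v)) RenamesBy (λ v → v) →
                  (F : Fm s Δ n) → psub σ (pren there F) ≡ F
psub-pren-there e F = trans (psub-pren _ there F) (trans (psub-renaming e F) (pren-id F))

instance-v₀ : ∀ {s Δ n} (A : Fm s Δ n) → ren (inst []) A ≡ A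
instance-v₀ = ren-id (λ _ → refl)

instance-v₁ : ∀ {s s' Δ n} (A : Fm s' Δ n) (B : Fm s Δ n) →
              psub (single A) (ren (inst []) (pren there B)) ≡ B
instance-v₁ A B = trans (cong (psub (single A)) (instance-v₀ (pren there B))) (psub-pren-there (λ _ → refl) B)

instance-v₂ : ∀ {s s' s'' Δ n} (A : Fm s' Δ n) (B : Fm s'' Δ n) (C : Fm s Δ n) →
              psub (single A) (psub (liftP (single B)) (ren (inst []) (pren there (pren there C)))) ≡ C
instance-v₂ {s' = s'} A B C =
  trans (cong (psub (single A)) (cong (psub (liftP (single B))) (instance-v₀ (pren there (pren there C)))))
        (trans (cong (psub (single A)) drop-v₁) (psub-pren-there (λ _ → refl) C))
  where
  drop-v₁ : psub (liftP {y = s' , 0} (single {k = 0} B)) (pren there (pren there C)) ≡ pren there C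
  drop-v₁ = trans (psub-pren (liftP (single B)) there (pren there C))
                  (trans (psub-pren _ there C) (psub-renaming (λ _ → refl) C))

instance-a₁ : ∀ {s Δ n} (θ : Fm s Δ (suc n)) → ren (inst (zero ∷ [])) (ren (shiftAmb 1) θ) ≡ θ
instance-a₁ = ren-∘-id λ { zero → refl ; (suc j) → refl }

instance-a₁-wk : ∀ {s s' Δ n} (q : Fm s' Δ n) (θ : Fm s Δ (suc n)) →
                 psub (liftI (single q)) (ren (inst (zero ∷ [])) (ren (shiftAmb 1) (pren there θ))) ≡ θ
instance-a₁-wk q θ = begin
  psub (liftI (single q)) (ren (inst (zero ∷ [])) (ren (shiftAmb 1) (pren there θ)))
    ≡⟨ cong (λ X → psub (liftI (single q)) (ren (inst (zero ∷ [])) X)) (ren-pren (shiftAmb 1) there θ) ⟩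
  psub (liftI (single q)) (ren (inst (zero ∷ [])) (pren there (ren (shiftAmb 1) θ)))
    ≡⟨ cong (psub (liftI (single q))) (ren-pren (inst (zero ∷ [])) there (ren (shiftAmb 1) θ)) ⟩
  psub (liftI (single q)) (pren there (ren (inst (zero ∷ [])) (ren (shiftAmb 1) θ)))
    ≡⟨ psub-pren-there (liftI-renamesBy (λ _ → refl)) _ ⟩
  ren (inst (zero ∷ [])) (ren (shiftAmb 1) θ)
    ≡⟨ instance-a₁ θ ⟩
  θ ∎
  where open ≡-Reasoning

tabulate-≗ : ∀ {a} {A : Set a} {m} {f g : Fin m → A} → tabulate f ≡ tabulate g → f ≗ g
tabulate-≗ {f = f} {g} e j =
  trans (sym (lookup∘tabulate f j)) (trans (cong (λ v → lookup v j) e) (lookup∘tabulate g j))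

conjunct : ∀ {Δ n} → ℕ → MF Δ n → MF Δ n
conjunct zero    (φ & _) = φ
conjunct (suc k) (_ & ψ) = conjunct k ψ
conjunct _       φ       = φ

⊢-conjunct : ∀ {Δ n} {Γ : List (MF Δ n)} k {φ} → Γ ⊢ φ → Γ ⊢ conjunct k φ
⊢-conjunct zero    {_ & _}   d = &E₁ d
⊢-conjunct (suc k) {_ & _}   d = ⊢-conjunct k (&E₂ d)
⊢-conjunct zero    {fm _}    d = d
⊢-conjunct zero    {_ ⟹ _}  d = d
⊢-conjunct zero    {Π₁ _}    d = d
⊢-conjunct zero    {Π₂ _ _}  d = d
⊢-conjunct (suc k) {fm _}    d = d
⊢-conjunct (suc k) {_ ⟹ _}  d = d
⊢-conjunct (suc k) {Π₁ _}    d = d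
⊢-conjunct (suc k) {Π₂ _ _}  d = d

-- On a concrete closed meta-formula, embed computes to a term that every
-- weakening wk₁, wk₂ maps to its embedding in the larger context; so the
-- hypothesis list QHC'-hyp is preserved by Π₁I and Π₂I.
embed : ∀ {Δ n} → MF [] 0 → MF Δ n
embed φ = mren (λ ()) (mpren (λ ()) φ)

QHC'-hyp : ∀ {Δ n} → List (MF Δ n)
QHC'-hyp = embed QHC' ∷ []

axiom : ∀ {Δ n} k → QHC'-hyp {Δ} {n} ⊢ conjunct k (embed QHC')
axiom k = ⊢-conjunct k (hyp (here refl))

lawOffset : Sort → ℕ
lawOffset c = 1
lawOffset i = 16

law : ∀ {Δ n} s (j : Fin 15) → QHC'-hyp {Δ} {n} ⊢ embed (List.lookup (logicLaws s) j)
law s j = subst (_ ⊢_) (position s j) (axiom (lawOffset s + toℕ j))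
  where
  -- For concrete m, refl proves tabulate f ≡ tabulate g: m definitional equalities at once.
  position : ∀ s → (λ j → conjunct (lawOffset s + toℕ j) (embed QHC')) ≗ (λ j → embed (List.lookup (logicLaws s) j))
  position c = tabulate-≗ refl
  position i = tabulate-≗ refl

-- Π₂E leaves the substituted formulas wrapped in the renamings and substitutions
-- performed by mpsub; P is the shape of the schema being instantiated.
module _ {Δ : Ctx} {n : ℕ} {Γ : List (MF Δ n)} where

  instantiate₁ : ∀ {s} (P : Fm s Δ n → MF Δ n) {A} → Γ ⊢ P (ren (inst []) A) → Γ ⊢ P A
  instantiate₁ P {A} = subst (λ X → Γ ⊢ P X) (instance-v₀ A)

  instantiate₂ : ∀ {s} (P : Fm s Δ n → Fm s Δ n → MF Δ n) {A B} →
                 Γ ⊢ P (ren (inst []) A) (psub (single A) (ren (inst []) (pren there B))) → Γ ⊢ P A B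
  instantiate₂ P {A} {B} = subst₂ (λ X Y → Γ ⊢ P X Y) (instance-v₀ A) (instance-v₁ A B)

  instantiate₃ : ∀ {s} (P : Fm s Δ n → Fm s Δ n → Fm s Δ n → MF Δ n) {A B C} →
                 Γ ⊢ P (ren (inst []) A) (psub (single A) (ren (inst []) (pren there B)))
                       (psub (single A) (psub (liftP (single B)) (ren (inst []) (pren there (pren there C))))) →
                 Γ ⊢ P A B C
  instantiate₃ {s} P {A} {B} {C} d =
    subst (λ Z → Γ ⊢ P A B Z) (instance-v₂ A B C) (instantiate₂ (λ X Y → P X Y raw-C) d)
    where
    raw-C : Fm s Δ n
    raw-C = psub (single A) (psub (liftP (single B)) (ren (inst []) (pren there (pren there C))))

  instantiate-quantifier-law : ∀ {s} (P : Fm s Δ (suc n) → Fm s Δ n → MF Δ n) {θ t} →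
                  Γ ⊢ P (ren (ext (inst₁ t)) (ren (inst (zero ∷ [])) (ren (shiftAmb 1) (ren (shiftAmb 1) θ))))
                        (ren (inst₁ t) (ren (inst (zero ∷ [])) (ren (shiftAmb 1) θ))) →
                  Γ ⊢ P θ (ren (inst₁ t) θ)
  instantiate-quantifier-law P {θ} {t} = subst₂ (λ X Y → Γ ⊢ P X Y) bound (cong (ren (inst₁ t)) (instance-a₁ θ))
    where
    bound : ren (ext (inst₁ t)) (ren (inst (zero ∷ [])) (ren (shiftAmb 1) (ren (shiftAmb 1) θ))) ≡ θ
    bound = trans (cong (ren (ext (inst₁ t))) (instance-a₁ (ren (shiftAmb 1) θ)))
                  (ren-∘-id (λ { zero → refl ; (suc j) → refl }) θ)

  instantiate-quantifier-rule : ∀ {s} (P : Fm s Δ (suc n) → Fm s Δ n → Fm s Δ (suc n) → MF Δ n) {q θ} →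
                   Γ ⊢ P (ren (inst []) (ren suc q)) (ren (inst []) q)
                         (psub (liftI (single q)) (ren (inst (zero ∷ [])) (ren (shiftAmb 1) (pren there θ)))) →
                   Γ ⊢ P (ren suc q) q θ
  instantiate-quantifier-rule {s} P {q} {θ} d =
    subst (λ Z → Γ ⊢ P (ren suc q) q Z) (instance-a₁-wk q θ)
          (subst₂ (λ X Y → Γ ⊢ P X Y raw-θ) (instance-v₀ (ren suc q)) (instance-v₀ q) d)
    where
    raw-θ : Fm s Δ (suc n)
    raw-θ = psub (liftI (single q)) (ren (inst (zero ∷ [])) (ren (shiftAmb 1) (pren there θ)))

module _ {Δ : Ctx} {n : ℕ} where

  QHC'⊢_ : ∀ {s} → Fm s Δ n → Set
  QHC'⊢ F = QHC'-hyp ⊢ fm F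

  mp : ∀ {s} {A B : Fm s Δ n} → QHC'⊢ A → QHC'⊢ (A ⇒ B) → QHC'⊢ B
  mp {s} {A} {B} d e =
    ⟹E (instantiate₂ (λ X Y → fm X & fm (X ⇒ Y) ⟹ fm Y) (Π₂E (Π₂E (law s (# 12)) B) A)) (&I d e)

  axK : ∀ {s} (A B : Fm s Δ n) → QHC'⊢ (A ⇒ (B ⇒ A))
  axK {s} A B = instantiate₂ (λ X Y → fm (X ⇒ (Y ⇒ X))) (Π₂E (Π₂E (law s (# 0)) B) A)

  axS : ∀ {s} (A B C : Fm s Δ n) → QHC'⊢ ((A ⇒ (B ⇒ C)) ⇒ ((A ⇒ B) ⇒ (A ⇒ C)))
  axS {s} A B C = instantiate₃ (λ X Y Z → fm ((X ⇒ (Y ⇒ Z)) ⇒ ((X ⇒ Y) ⇒ (X ⇒ Z))))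
                               (Π₂E (Π₂E (Π₂E (law s (# 1)) C) B) A)

  ∧-elimˡ : ∀ {s} (A B : Fm s Δ n) → QHC'⊢ (A ∧ B ⇒ A)
  ∧-elimˡ {s} A B = instantiate₂ (λ X Y → fm (X ∧ Y ⇒ X)) (Π₂E (Π₂E (law s (# 2)) B) A)

  ∧-elimʳ : ∀ {s} (A B : Fm s Δ n) → QHC'⊢ (A ∧ B ⇒ B)
  ∧-elimʳ {s} A B = instantiate₂ (λ X Y → fm (X ∧ Y ⇒ Y)) (Π₂E (Π₂E (law s (# 3)) B) A)

  ∧-intro : ∀ {s} (A B : Fm s Δ n) → QHC'⊢ (A ⇒ (B ⇒ A ∧ B))
  ∧-intro {s} A B = instantiate₂ (λ X Y → fm (X ⇒ (Y ⇒ X ∧ Y))) (Π₂E (Π₂E (law s (# 4)) B) A)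

  ∨-introˡ : ∀ {s} (A B : Fm s Δ n) → QHC'⊢ (A ⇒ A ∨ B)
  ∨-introˡ {s} A B = instantiate₂ (λ X Y → fm (X ⇒ X ∨ Y)) (Π₂E (Π₂E (law s (# 5)) B) A)

  ∨-introʳ : ∀ {s} (A B : Fm s Δ n) → QHC'⊢ (B ⇒ A ∨ B)
  ∨-introʳ {s} A B = instantiate₂ (λ X Y → fm (Y ⇒ X ∨ Y)) (Π₂E (Π₂E (law s (# 6)) B) A)

  ∨-elim : ∀ {s} (A B C : Fm s Δ n) → QHC'⊢ ((A ⇒ C) ⇒ ((B ⇒ C) ⇒ (A ∨ B ⇒ C)))
  ∨-elim {s} A B C = instantiate₃ (λ X Y Z → fm ((X ⇒ Z) ⇒ ((Y ⇒ Z) ⇒ (X ∨ Y ⇒ Z))))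
                                  (Π₂E (Π₂E (Π₂E (law s (# 7)) C) B) A)

  ff-elim : ∀ {s} (A : Fm s Δ n) → QHC'⊢ (ff ⇒ A)
  ff-elim {s} A = instantiate₁ (λ X → fm (ff ⇒ X)) (Π₂E (law s (# 8)) A)

  ‼-rule : ∀ {F : Fm c Δ n} → QHC'⊢ F → QHC'⊢ ‼ F
  ‼-rule {F} = ⟹E (instantiate₁ (λ X → fm X ⟹ fm (‼ X)) (Π₂E (axiom 31) F))

  ¿-rule : ∀ {A : Fm i Δ n} → QHC'⊢ A → QHC'⊢ ¿ A
  ¿-rule {A} = ⟹E (instantiate₁ (λ X → fm X ⟹ fm (¿ X)) (Π₂E (axiom 32) A))

  ¿‼-counit : (F : Fm c Δ n) → QHC'⊢ (¿ (‼ F) ⇒ F)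
  ¿‼-counit F = instantiate₁ (λ X → fm (¿ (‼ X) ⇒ X)) (Π₂E (axiom 33) F)

  ‼¿-unit : (A : Fm i Δ n) → QHC'⊢ (A ⇒ ‼ (¿ A))
  ‼¿-unit A = instantiate₁ (λ X → fm (X ⇒ ‼ (¿ X))) (Π₂E (axiom 34) A)

  ‼-K : (F G : Fm c Δ n) → QHC'⊢ (‼ (F ⇒ G) ⇒ (‼ F ⇒ ‼ G))
  ‼-K F G = instantiate₂ (λ X Y → fm (‼ (X ⇒ Y) ⇒ (‼ X ⇒ ‼ Y))) (Π₂E (Π₂E (axiom 35) G) F)

  ¿-K : (A B : Fm i Δ n) → QHC'⊢ (¿ (A ⇒ B) ⇒ (¿ A ⇒ ¿ B))
  ¿-K A B = instantiate₂ (λ X Y → fm (¿ (X ⇒ Y) ⇒ (¿ X ⇒ ¿ Y))) (Π₂E (Π₂E (axiom 36) B) A)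

  ∀-elim : ∀ {s} (θ : Fm s Δ (suc n)) (t : Fin n) → QHC'⊢ (∀' θ ⇒ ren (inst₁ t) θ)
  ∀-elim {s} θ t = instantiate-quantifier-law (λ X Y → fm (∀' X ⇒ Y)) (Π₁E (Π₂E (law s (# 10)) θ) t)

  ∃-intro : ∀ {s} (θ : Fm s Δ (suc n)) (t : Fin n) → QHC'⊢ (ren (inst₁ t) θ ⇒ ∃' θ)
  ∃-intro {s} θ t = instantiate-quantifier-law (λ X Y → fm (Y ⇒ ∃' X)) (Π₁E (Π₂E (law s (# 11)) θ) t)

  ∀-intro : ∀ {s} (q : Fm s Δ n) (θ : Fm s Δ (suc n)) → QHC'-hyp ⊢ fm (ren suc q ⇒ θ) → QHC'⊢ (q ⇒ ∀' θ)
  ∀-intro {s} q θ d =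
    ⟹E (instantiate-quantifier-rule (λ Q₁ Q Y → Π₁ (fm (Q₁ ⇒ Y)) ⟹ fm (Q ⇒ ∀' Y)) (Π₂E (Π₂E (law s (# 13)) θ) q)) (Π₁I d)

  ∃-elim : ∀ {s} (q : Fm s Δ n) (θ : Fm s Δ (suc n)) → QHC'-hyp ⊢ fm (θ ⇒ ren suc q) → QHC'⊢ (∃' θ ⇒ q)
  ∃-elim {s} q θ d =
    ⟹E (instantiate-quantifier-rule (λ Q₁ Q Y → Π₁ (fm (Y ⇒ Q₁)) ⟹ fm (∃' Y ⇒ Q)) (Π₂E (Π₂E (law s (# 14)) θ) q)) (Π₁I d)

  ⇒-trans : ∀ {s} {A B C : Fm s Δ n} → QHC'⊢ (A ⇒ B) → QHC'⊢ (B ⇒ C) → QHC'⊢ (A ⇒ C)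
  ⇒-trans {A = A} {B} {C} d e = mp d (mp (mp e (axK (B ⇒ C) A)) (axS A B C))

  ∧-pair : ∀ {s} {A B : Fm s Δ n} → QHC'⊢ A → QHC'⊢ B → QHC'⊢ (A ∧ B)
  ∧-pair {A = A} {B} d e = mp e (mp d (∧-intro A B))

  ⇒-∧ : ∀ {s} {A B C : Fm s Δ n} → QHC'⊢ (A ⇒ B) → QHC'⊢ (A ⇒ C) → QHC'⊢ (A ⇒ B ∧ C)
  ⇒-∧ {A = A} {B} {C} d e = mp e (mp (⇒-trans d (∧-intro B C)) (axS A C (B ∧ C)))

  uncurry : ∀ {s} {A B C : Fm s Δ n} → QHC'⊢ (A ⇒ (B ⇒ C)) → QHC'⊢ (A ∧ B ⇒ C)
  uncurry {A = A} {B} {C} d = mp (∧-elimʳ A B) (mp (⇒-trans (∧-elimˡ A B) d) (axS (A ∧ B) B C))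

  ∨-⇒ : ∀ {s} {A B C : Fm s Δ n} → QHC'⊢ (A ⇒ C) → QHC'⊢ (B ⇒ C) → QHC'⊢ (A ∨ B ⇒ C)
  ∨-⇒ {A = A} {B} {C} d e = mp e (mp d (∨-elim A B C))

  ¿-mono : {A B : Fm i Δ n} → QHC'⊢ (A ⇒ B) → QHC'⊢ (¿ A ⇒ ¿ B)
  ¿-mono {A} {B} d = mp (¿-rule d) (¿-K A B)

  ‼-mono : {F G : Fm c Δ n} → QHC'⊢ (F ⇒ G) → QHC'⊢ (‼ F ⇒ ‼ G)
  ‼-mono {F} {G} d = mp (‼-rule d) (‼-K F G)

  ¿⊣‼ : {A : Fm i Δ n} {F : Fm c Δ n} → QHC'⊢ (A ⇒ ‼ F) → QHC'⊢ (¿ A ⇒ F)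
  ¿⊣‼ {F = F} d = ⇒-trans (¿-mono d) (¿‼-counit F)

  ¿-∧ : (A B : Fm i Δ n) → QHC'⊢ (¿ (A ∧ B) ⇔ ¿ A ∧ ¿ B)
  ¿-∧ A B = ∧-pair (⇒-∧ (¿-mono (∧-elimˡ A B)) (¿-mono (∧-elimʳ A B)))
                   (uncurry (⇒-trans (¿-mono (∧-intro A B)) (¿-K B (A ∧ B))))

  ¿-∨ : (A B : Fm i Δ n) → QHC'⊢ (¿ (A ∨ B) ⇔ ¿ A ∨ ¿ B)
  ¿-∨ A B = ∧-pair (¿⊣‼ (∨-⇒ (⇒-trans (‼¿-unit A) (‼-mono (∨-introˡ (¿ A) (¿ B))))
                           (⇒-trans (‼¿-unit B) (‼-mono (∨-introʳ (¿ A) (¿ B))))))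
                   (∨-⇒ (¿-mono (∨-introˡ A B)) (¿-mono (∨-introʳ A B)))

  ¬¿ff : QHC'⊢ (¬ ¿ ff)
  ¬¿ff = ¿⊣‼ (ff-elim (‼ ff))

module _ {Δ : Ctx} {n : ℕ} where

  ∃-intro-var : ∀ {s} (θ : Fm s Δ (suc n)) → QHC'⊢ (θ ⇒ ren suc (∃' θ))
  ∃-intro-var θ = subst (λ X → QHC'⊢ (X ⇒ ∃' (ren (ext suc) θ)))
                        (ren-∘-id (λ { zero → refl ; (suc j) → refl }) θ) (∃-intro (ren (ext suc) θ) zero)

  ∀-elim-var : ∀ {s} (θ : Fm s Δ (suc n)) → QHC'⊢ (ren suc (∀' θ) ⇒ θ)
  ∀-elim-var θ = subst (λ X → QHC'⊢ (∀' (ren (ext suc) θ) ⇒ X))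
                       (ren-∘-id (λ { zero → refl ; (suc j) → refl }) θ) (∀-elim (ren (ext suc) θ) zero)

  ¿-∃ : (θ : Fm i Δ (suc n)) → QHC'⊢ (¿ (∃' θ) ⇔ ∃' (¿ θ))
  ¿-∃ θ = ∧-pair (¿⊣‼ (∃-elim (‼ (∃' (¿ θ))) θ (⇒-trans (‼¿-unit θ) (‼-mono (∃-intro-var (¿ θ))))))
                 (∃-elim (¿ (∃' θ)) (¿ θ) (¿-mono (∃-intro-var θ)))

  ¿-∀ : (θ : Fm i Δ (suc n)) → QHC'⊢ (¿ (∀' θ) ⇒ ∀' (¿ θ))
  ¿-∀ θ = ∀-intro (¿ (∀' θ)) (¿ θ) (¿-mono (∀-elim-var θ))

infixr 3 _&*_

_&*_ : ∀ {Δ n} → List (MF Δ n) → MF Δ n → MF Δ n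
[]       &* ψ = ψ
(φ ∷ φs) &* ψ = φ & (φs &* ψ)

&*-map : ∀ {Δ n} {Γ : List (MF Δ n)} φs {ψ χ} → Γ ⊢ φs &* ψ → (Γ ⊢ ψ → Γ ⊢ χ) → Γ ⊢ φs &* χ
&*-map []       d f = f d
&*-map (φ ∷ φs) d f = &I (&E₁ d) (&*-map φs (&E₂ d) f)

-- Conjuncts 40, 28 and 37 of QHC are (2c), modus ponens for i-formulas and (1g).
QHC⊢¿-rule : (QHC ∷ []) ⊢ rule (ctx i 1) ((0 , i , a₀ v₀) ∷⁺ []) (0 , c , ¿ (a₀ v₀))
QHC⊢¿-rule = Π₂I (⟹I (⟹E (Π₂E (qhc 40) (¿ α)) ‼¿α))
  where
  α : Fm i ((i , 0) ∷ []) 0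
  α = a₀ v₀
  qhc : ∀ k → (fm α ∷ embed QHC ∷ []) ⊢ conjunct k (embed QHC)
  qhc k = ⊢-conjunct k (hyp (there (here refl)))
  ‼¿α : (fm α ∷ embed QHC ∷ []) ⊢ fm (‼ (¿ α))
  ‼¿α = ⟹E (Π₂E (Π₂E (qhc 28) (‼ (¿ α))) α) (&I (hyp (here refl)) (Π₂E (qhc 37) α))

-- Conjuncts 13, 33 and 32 of QHC' are modus ponens for c-formulas, ?!p → p and α/?α.
QHC'⊢‼-rule⁻¹ : QHC'-hyp ⊢ rule (ctx c 1) ((0 , i , ‼ (a₀ v₀)) ∷⁺ []) (0 , c , a₀ v₀)
QHC'⊢‼-rule⁻¹ = Π₂I (⟹I (⟹E (Π₂E (Π₂E (qhc' 13) p) (¿ (‼ p))) (&I ¿‼p (Π₂E (qhc' 33) p))))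
  where
  p : Fm c ((c , 0) ∷ []) 0
  p = a₀ v₀
  qhc' : ∀ k → (fm (‼ p) ∷ QHC'-hyp) ⊢ conjunct k (embed QHC')
  qhc' k = ⊢-conjunct k (hyp (there (here refl)))
  ¿‼p : (fm (‼ p) ∷ QHC'-hyp) ⊢ fm (¿ (‼ p))
  ¿‼p = ⟹E (Π₂E (qhc' 32) (‼ p)) (hyp (here refl))

-- The conjuncts of t are (1a)–(2f), numbered from 0.
QHC⊢QHC' : (QHC ∷ []) ⊢ QHC'
QHC⊢QHC' = &*-map (QC ++ QH) (hyp (here refl)) λ t →
  &I (⊢-conjunct 12 t) (&I QHC⊢¿-rule (&I (⊢-conjunct 8 t) (&I (⊢-conjunct 6 t)
    (&I (⊢-conjunct 11 t) (&I (⊢-conjunct 2 t) (⊢-conjunct 7 t))))))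

-- The conjuncts of t are the seven modal axioms and rules of QHC', numbered from 0.
QHC'⊢QHC : (QHC' ∷ []) ⊢ QHC
QHC'⊢QHC = &*-map (QC ++ QH) (hyp (here refl)) λ t →
  &I (Π₂I (Π₂I (¿-∧ _ _))) (&I (Π₂I (Π₂I (¿-∨ _ _))) (&I (⊢-conjunct 5 t) (&I ¬¿ff
    (&I (Π₂I (¿-∃ _)) (&I (Π₂I (¿-∀ _)) (&I (⊢-conjunct 3 t) (&I (⊢-conjunct 6 t)
    (&I (⊢-conjunct 2 t) (&I QHC'⊢‼-rule⁻¹ (&I (Π₂I (‼¿-unit _)) (&I (⊢-conjunct 4 t)
    (⊢-conjunct 0 t))))))))))))

mainTheorem6 : Equivalent QHC QHC'
mainTheorem6 = &I (⟹I QHC⊢QHC') (⟹I QHC'⊢QHC)
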